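{- Let $x=\langle d,k,m\rangle$ and $y=\langle d',k',m'\rangle$ be nonzero elements of $M_n$. Then: (1) $xy=yx\ne\mathbf{0}$ if and only if $$\max(k,k'-d)=\max(k',k-d')\le\min(m,m'-d)=\min(m',m-d');$$ (2) $xy=yx=\mathbf{0}$ if and only if $$\max(k,k'-d)>\min(m,m'-d)\quad\text{and}\quad\max(k',k-d')>\min(m',m-d').$$
   Context: Fix an integer $n\ge 2$. For integers $d,k,m$ with $1-\min(0,d)\le k\le m\le n-\max(0,d)$, let $\langle d,k,m\rangle$ denote the $n\times n$ matrix with entries $x_{ij}$ ($i,j\in\{1,\dots,n\}$) equal to $1$ if $k\le i\le m$ and $j-i=d$, and $0$ otherwise. Let $\mathbf{0}$ be the $n\times n$ zero matrix and $M_n=\{\mathbf{0}\}\cup\{\langle d,k,m\rangle: d\in\mathbb{Z},\ k,m\in\mathbb{N},\ 1-\min(0,d)\le k\le m\le n-\max(0,d)\}$, a monoid under matrix multiplication. -}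

module Defs where

open import Data.Nat as ℕ using (ℕ; zero; suc)
open import Data.Integer as ℤ using (ℤ; +_; _-_; _⊔_; _⊓_)
open import Data.Fin using (Fin; toℕ) renaming (zero to fzero; suc to fsuc)
open import Data.Bool using (Bool; true; false; if_then_else_; _∧_)
open import Relation.Nullary.Decidable using (⌊_⌋)
open import Relation.Binary.PropositionalEquality using (_≡_)
open import Data.Product using (_×_)

-- n × n matrices over ℕ (entries will be 0/1)
Matrix : ℕ → Set
Matrix n = Fin n → Fin n → ℕ

sumFin : (n : ℕ) → (Fin n → ℕ) → ℕ
sumFin zero    f = 0
sumFin (suc n) f = f fzero ℕ.+ sumFin n (λ i → f (fsuc i))

_⊗_ : {n : ℕ} → Matrix n → Matrix n → Matrix n
_⊗_ {n} A B i j = sumFin n (λ l → A i l ℕ.* B l j)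

_≈ₘ_ : {n : ℕ} → Matrix n → Matrix n → Set
_≈ₘ_ {n} A B = (i j : Fin n) → A i j ≡ B i j

𝟎 : {n : ℕ} → Matrix n
𝟎 i j = 0

-- 1-based index of a Fin, as an integer
idx : {n : ℕ} → Fin n → ℤ
idx i = + suc (toℕ i)

⟨_,_,_⟩ : {n : ℕ} → ℤ → ℕ → ℕ → Matrix n
⟨ d , k , m ⟩ i j =
  if ⌊ + k ℤ.≤? idx i ⌋ ∧ ⌊ idx i ℤ.≤? + m ⌋ ∧ ⌊ idx j - idx i ℤ.≟ d ⌋
  then 1 else 0

-- parameter constraint: 1 - min(0,d) ≤ k ≤ m ≤ n - max(0,d)
-- (k, m ∈ ℕ); exactly the nonzero elements of M_n
Valid : ℕ → ℤ → ℕ → ℕ → Set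
Valid n d k m =
  (+ 1 - (+ 0 ⊓ d) ℤ.≤ + k) × (k ℕ.≤ m) × (+ m ℤ.≤ + n - (+ 0 ⊔ d))

-- Write band a b e for the 0/1 matrix with entry 1 at (i, i+e) for a ≤ i ≤ b; thus
-- ⟨d,k,m⟩ = band k m d. Multiplying bands composes the diagonal shifts, and the
-- entry at (i, i+e+e′) of band a b e · band a′ b′ e′ is 1 iff i ∈ [a, b] and the
-- intermediate index i+e ∈ [a′, b′]: the product is band (a ⊔ (a′-e)) (b ⊓ (b′-e)) (e+e′).
-- For the elements of M_n every row of these bands, with its column, lies inside the
-- n × n grid, so a band is zero iff its row interval is empty, and two nonempty bands
-- on the same diagonal are equal iff their row intervals coincide. Both products xy
-- and yx lie on the diagonal d+d′, which gives (1) and (2).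
module Submission where

open import Defs
open import Data.Nat using (ℕ; _≤_)
open import Data.Integer using (ℤ; +_; _-_; _⊔_; _⊓_; _>_) renaming (_≤_ to _≤ℤ_)
open import Data.Product using (_×_)
open import Function.Bundles using (_⇔_)
open import Relation.Binary.PropositionalEquality using (_≡_)
open import Relation.Nullary using (¬_)

import Data.Nat as ℕ
import Data.Nat.Properties as ℕ
open import Data.Integer using (_+_; -_; _<_; _≤?_; _≟_; +≤+)
open import Data.Integer.Properties
  using ( ≤-refl; ≤-trans; ≤-antisym; ≰⇒>; ≮⇒≥; ≤⇒≯; module ≤-Reasoning
        ; +-comm; +-assoc; +-identityʳ; +-monoˡ-≤; +-monoʳ-≤; +-injective; drop‿+≤+
        ; i≤i⊔j; i≤j⊔i; i⊓j≤i; i⊓j≤j; ⊔-lub; ⊓-glb )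
open import Data.Integer.Tactic.RingSolver using (solve-∀)
open import Data.Fin using (Fin; fromℕ<) renaming (zero to fzero; suc to fsuc)
open import Data.Fin.Properties using (toℕ-injective; toℕ-fromℕ<; suc-injective)
open import Data.Product using (Σ-syntax; _,_; proj₁; proj₂)
open import Data.Product.Function.NonDependent.Propositional using (_×-⇔_)
open import Function.Base using (_∘_)
open import Function.Bundles using (mk⇔; module Equivalence)
open import Data.Bool using (if_then_else_; _∧_)
open import Relation.Binary.PropositionalEquality
  using (refl; sym; trans; cong; cong₂; subst; _≢_; module ≡-Reasoning)
open import Relation.Nullary using (Dec; yes; no; contradiction)
open import Relation.Nullary.Decidable using (_×-dec_; ⌊_⌋)

open Equivalence using (to; from)

private
  variable
    n : ℕ
    a b e p : ℤ
    i j : Fin n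

i-j+j≡i : ∀ i j → i - j + j ≡ i
i-j+j≡i = solve-∀

i+j-j≡i : ∀ i j → i + j - j ≡ i
i+j-j≡i = solve-∀

i+j-i≡j : ∀ i j → i + j - i ≡ j
i+j-i≡j = solve-∀

i≡j+[i-j] : ∀ i j → i ≡ j + (i - j)
i≡j+[i-j] = solve-∀

i-k≡[i-j]+[j-k] : ∀ i j k → i - k ≡ (i - j) + (j - k)
i-k≡[i-j]+[j-k] = solve-∀

i-[j+k]≡i-j-k : ∀ i j k → i - (j + k) ≡ i - j - k
i-[j+k]≡i-j-k = solve-∀

i-k≤j⇒i≤j+k : ∀ {i j} k → i - k ≤ℤ j → i ≤ℤ j + k
i-k≤j⇒i≤j+k {i} {j} k p = subst (_≤ℤ j + k) (i-j+j≡i i k) (+-monoˡ-≤ k p)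

i≤j+k⇒i-k≤j : ∀ {i j} k → i ≤ℤ j + k → i - k ≤ℤ j
i≤j+k⇒i-k≤j {i} {j} k p = subst (i - k ≤ℤ_) (i+j-j≡i j k) (+-monoˡ-≤ (- k) p)

i≤j-k⇒i+k≤j : ∀ {i j} k → i ≤ℤ j - k → i + k ≤ℤ j
i≤j-k⇒i+k≤j {i} {j} k p = subst (i + k ≤ℤ_) (i-j+j≡i j k) (+-monoˡ-≤ k p)

i+k≤j⇒i≤j-k : ∀ {i j} k → i + k ≤ℤ j → i ≤ℤ j - k
i+k≤j⇒i≤j-k {i} {j} k p = subst (_≤ℤ j - k) (i+j-j≡i i k) (+-monoˡ-≤ (- k) p)

i-j≡k⇒i≡j+k : ∀ {i j k} → i - j ≡ k → i ≡ j + k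
i-j≡k⇒i≡j+k {i} {j} i-j≡k = trans (i≡j+[i-j] i j) (cong (_+_ j) i-j≡k)

idx-injective : idx i ≡ idx j → i ≡ j
idx-injective eq = toℕ-injective (ℕ.suc-injective (+-injective eq))

idx-surjective : + 1 ≤ℤ p → p ≤ℤ + n → Σ[ i ∈ Fin n ] idx i ≡ p
idx-surjective {+ ℕ.zero}  (+≤+ ()) _
idx-surjective {+ ℕ.suc q} _ q<n =
  fromℕ< (drop‿+≤+ q<n) , cong (λ t → + ℕ.suc t) (toℕ-fromℕ< _)

sumFin-zero : ∀ n (f : Fin n → ℕ) → (∀ l → f l ≡ 0) → sumFin n f ≡ 0
sumFin-zero ℕ.zero    f f≡0 = refl
sumFin-zero (ℕ.suc n) f f≡0 rewrite f≡0 fzero =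
  sumFin-zero n (λ l → f (fsuc l)) (λ l → f≡0 (fsuc l))

sumFin-single : ∀ n (f : Fin n → ℕ) l₀ → f l₀ ≡ 1 → (∀ l → l ≢ l₀ → f l ≡ 0) → sumFin n f ≡ 1
sumFin-single (ℕ.suc n) f fzero f≡1 f≡0 rewrite f≡1 =
  cong ℕ.suc (sumFin-zero n _ (λ l → f≡0 (fsuc l) (λ ())))
sumFin-single (ℕ.suc n) f (fsuc l₀) f≡1 f≡0 rewrite f≡0 fzero (λ ()) =
  sumFin-single n _ l₀ f≡1 (λ l l≢l₀ → f≡0 (fsuc l) (l≢l₀ ∘ suc-injective))

OnBand : ℤ → ℤ → ℤ → Fin n → Fin n → Set
OnBand a b e i j = (a ≤ℤ idx i) × (idx i ≤ℤ b) × (idx j - idx i ≡ e)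

onBand? : ∀ a b e (i j : Fin n) → Dec (OnBand a b e i j)
onBand? a b e i j = (a ≤? idx i) ×-dec (idx i ≤? b) ×-dec (idx j - idx i ≟ e)

-- Spelled exactly like ⟨_,_,_⟩, so that ⟨ d , k , m ⟩ and band (+ k) (+ m) d agree definitionally.
band : ℤ → ℤ → ℤ → Matrix n
band a b e i j = if ⌊ a ≤? idx i ⌋ ∧ ⌊ idx i ≤? b ⌋ ∧ ⌊ idx j - idx i ≟ e ⌋ then 1 else 0

band-on : OnBand a b e i j → band a b e i j ≡ 1
band-on {a = a} {b} {e} {i = i} {j} (a≤i , i≤b , j-i≡e)
  with a ≤? idx i | idx i ≤? b | idx j - idx i ≟ e
... | yes _   | yes _   | yes _    = refl
... | no a≰i  | _       | _        = contradiction a≤i a≰i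
... | yes _   | no i≰b  | _        = contradiction i≤b i≰b
... | yes _   | yes _   | no j-i≢e = contradiction j-i≡e j-i≢e

band-off : ¬ OnBand a b e i j → band a b e i j ≡ 0
band-off {a = a} {b} {e} {i = i} {j} ¬on
  with a ≤? idx i | idx i ≤? b | idx j - idx i ≟ e
... | yes a≤i | yes i≤b | yes j-i≡e = contradiction (a≤i , i≤b , j-i≡e) ¬on
... | no _    | _       | _         = refl
... | yes _   | no _    | _         = refl
... | yes _   | yes _   | no _      = refl

band-support : band a b e i j ≡ 1 → OnBand a b e i j
band-support {a = a} {b} {e} {i = i} {j} band≡1 with onBand? a b e i j
... | yes on = on
... | no ¬on with trans (sym band≡1) (band-off ¬on)
...   | ()

onBand-∘ : ∀ {a b e a′ b′ e′} {i l j : Fin n}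
         → OnBand a b e i l → OnBand a′ b′ e′ l j
         → OnBand (a ⊔ (a′ - e)) (b ⊓ (b′ - e)) (e + e′) i j
onBand-∘ {e = e} {a′ = a′} {b′} {e′} {i} {l} {j}
         (a≤i , i≤b , l-i≡e) (a′≤l , l≤b′ , j-l≡e′) =
  ⊔-lub a≤i (i≤j+k⇒i-k≤j e (subst (a′ ≤ℤ_) l≡i+e a′≤l)) ,
  ⊓-glb i≤b (i+k≤j⇒i≤j-k e (subst (_≤ℤ b′) l≡i+e l≤b′)) ,
  j-i≡e+e′
  where
  open ≡-Reasoning
  l≡i+e : idx l ≡ idx i + e
  l≡i+e = i-j≡k⇒i≡j+k {idx l} {idx i} l-i≡e
  j-i≡e+e′ : idx j - idx i ≡ e + e′
  j-i≡e+e′ = begin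
    idx j - idx i                     ≡⟨ i-k≡[i-j]+[j-k] (idx j) (idx l) (idx i) ⟩
    (idx j - idx l) + (idx l - idx i) ≡⟨ cong₂ _+_ j-l≡e′ l-i≡e ⟩
    e′ + e                            ≡⟨ +-comm e′ e ⟩
    e + e′                            ∎

onBand-middle : ∀ {a b e a′ b′ e′} {i j : Fin n}
              → OnBand (a ⊔ (a′ - e)) (b ⊓ (b′ - e)) (e + e′) i j
              → a′ ≤ℤ idx i + e × idx i + e ≤ℤ b′
onBand-middle {a = a} {b} {e} (A≤i , i≤B , _) =
  i-k≤j⇒i≤j+k e (≤-trans (i≤j⊔i a _) A≤i) , i≤j-k⇒i+k≤j e (≤-trans i≤B (i⊓j≤j b _))

onBand-split : ∀ {a b e a′ b′ e′} {i j l : Fin n}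
             → OnBand (a ⊔ (a′ - e)) (b ⊓ (b′ - e)) (e + e′) i j → idx l ≡ idx i + e
             → OnBand a b e i l × OnBand a′ b′ e′ l j
onBand-split {a = a} {b} {e} {a′} {b′} {e′} {i} {j} {l}
             on@(A≤i , i≤B , j-i≡e+e′) l≡i+e =
  (≤-trans (i≤i⊔j a _) A≤i , ≤-trans i≤B (i⊓j≤i b _) , l-i≡e) ,
  (subst (a′ ≤ℤ_) (sym l≡i+e) (proj₁ a′≤i+e≤b′) ,
   subst (_≤ℤ b′) (sym l≡i+e) (proj₂ a′≤i+e≤b′) ,
   j-l≡e′)
  where
  open ≡-Reasoning
  a′≤i+e≤b′ : a′ ≤ℤ idx i + e × idx i + e ≤ℤ b′
  a′≤i+e≤b′ = onBand-middle {a = a} {b} {e} {a′} {b′} {e′} on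
  l-i≡e : idx l - idx i ≡ e
  l-i≡e = trans (cong (_- idx i) l≡i+e) (i+j-i≡j (idx i) e)
  j-l≡e′ : idx j - idx l ≡ e′
  j-l≡e′ = begin
    idx j - idx l         ≡⟨ cong (_-_ (idx j)) l≡i+e ⟩
    idx j - (idx i + e)   ≡⟨ i-[j+k]≡i-j-k (idx j) (idx i) e ⟩
    idx j - idx i - e     ≡⟨ cong (_- e) j-i≡e+e′ ⟩
    e + e′ - e            ≡⟨ cong (_- e) (+-comm e e′) ⟩
    e′ + e - e            ≡⟨ i+j-j≡i e′ e ⟩
    e′                    ∎

record Fits (n : ℕ) (a b e : ℤ) : Set where
  constructor mkFits
  field
    1≤a   : + 1 ≤ℤ a
    b≤n   : b ≤ℤ + n
    1≤a+e : + 1 ≤ℤ a + e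
    b+e≤n : b + e ≤ℤ + n

band-row : Fits n a b e → a ≤ℤ p → p ≤ℤ b
         → Σ[ i ∈ Fin n ] Σ[ j ∈ Fin n ] idx i ≡ p × OnBand a b e i j
band-row {e = e} (mkFits 1≤a b≤n 1≤a+e b+e≤n) a≤p p≤b
  with idx-surjective (≤-trans 1≤a a≤p) (≤-trans p≤b b≤n)
     | idx-surjective (≤-trans 1≤a+e (+-monoˡ-≤ e a≤p)) (≤-trans (+-monoˡ-≤ e p≤b) b+e≤n)
... | i , refl | j , j≡i+e =
  i , j , refl , a≤p , p≤b , trans (cong (_- idx i) j≡i+e) (i+j-i≡j (idx i) e)

band-⊗ : ∀ {a b e a′ b′ e′} → Fits n a′ b′ e′
       → (band a b e ⊗ band a′ b′ e′) ≈ₘ band (a ⊔ (a′ - e)) (b ⊓ (b′ - e)) (e + e′)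
band-⊗ {n} {a} {b} {e} {a′} {b′} {e′} (mkFits 1≤a′ b′≤n _ _) i j
  with onBand? (a ⊔ (a′ - e)) (b ⊓ (b′ - e)) (e + e′) i j
... | yes on = trans (sumFin-single n term l₀ term-l₀ term-other) (sym (band-on on))
  where
  term : Fin n → ℕ
  term l = band a b e i l ℕ.* band a′ b′ e′ l j
  a′≤i+e≤b′ : a′ ≤ℤ idx i + e × idx i + e ≤ℤ b′
  a′≤i+e≤b′ = onBand-middle {a = a} {b} {e} {a′} {b′} {e′} on
  middle : Σ[ l ∈ Fin n ] idx l ≡ idx i + e
  middle = idx-surjective (≤-trans 1≤a′ (proj₁ a′≤i+e≤b′)) (≤-trans (proj₂ a′≤i+e≤b′) b′≤n)
  l₀ = proj₁ middle
  term-l₀ : term l₀ ≡ 1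
  term-l₀ = cong₂ ℕ._*_ (band-on (proj₁ split)) (band-on (proj₂ split))
    where split = onBand-split {a = a} {b} {e} {a′} {b′} {e′} on (proj₂ middle)
  term-other : ∀ l → l ≢ l₀ → term l ≡ 0
  term-other l l≢l₀ = cong (ℕ._* band a′ b′ e′ l j) (band-off {a = a} {b} {e} off-diagonal)
    where
    off-diagonal : ¬ OnBand a b e i l
    off-diagonal (_ , _ , l-i≡e) =
      l≢l₀ (idx-injective (trans (i-j≡k⇒i≡j+k {idx l} {idx i} l-i≡e) (sym (proj₂ middle))))
... | no ¬on = trans (sumFin-zero n _ term≡0) (sym (band-off ¬on))
  where
  term≡0 : ∀ l → band a b e i l ℕ.* band a′ b′ e′ l j ≡ 0
  term≡0 l with onBand? a b e i l | onBand? a′ b′ e′ l j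
  ... | no ¬p  | _      = cong (ℕ._* band a′ b′ e′ l j) (band-off ¬p)
  ... | yes _  | no ¬q  =
    trans (cong (band a b e i l ℕ.*_) (band-off ¬q)) (ℕ.*-zeroʳ (band a b e i l))
  ... | yes p  | yes q  = contradiction (onBand-∘ p q) ¬on

fits-⊗ : ∀ {a b e a′ b′ e′} → Fits n a b e → Fits n a′ b′ e′
       → Fits n (a ⊔ (a′ - e)) (b ⊓ (b′ - e)) (e + e′)
fits-⊗ {n} {a} {b} {e} {a′} {b′} {e′} (mkFits 1≤a b≤n _ _) (mkFits _ _ 1≤a′+e′ b′+e′≤n) =
  mkFits (≤-trans 1≤a (i≤i⊔j a _)) (≤-trans (i⊓j≤i b _) b≤n) 1≤A+e+e′ B+e+e′≤n
  where
  open ≤-Reasoning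
  A = a ⊔ (a′ - e)
  B = b ⊓ (b′ - e)
  1≤A+e+e′ : + 1 ≤ℤ A + (e + e′)
  1≤A+e+e′ = begin
    + 1          ≤⟨ 1≤a′+e′ ⟩
    a′ + e′      ≤⟨ +-monoˡ-≤ e′ (i-k≤j⇒i≤j+k {a′} {A} e (i≤j⊔i a (a′ - e))) ⟩
    A + e + e′   ≡⟨ +-assoc A e e′ ⟩
    A + (e + e′) ∎
  B+e+e′≤n : B + (e + e′) ≤ℤ + n
  B+e+e′≤n = begin
    B + (e + e′) ≡⟨ sym (+-assoc B e e′) ⟩
    B + e + e′   ≤⟨ +-monoˡ-≤ e′ (i≤j-k⇒i+k≤j {B} {b′} e (i⊓j≤j b (b′ - e))) ⟩
    b′ + e′      ≤⟨ b′+e′≤n ⟩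
    + n          ∎

valid⇒fits : ∀ {n d k m} → Valid n d k m → Fits n (+ k) (+ m) d
valid⇒fits {n} {d} {k} {m} (1-[0⊓d]≤k , _ , m≤n-[0⊔d]) = mkFits
  (subst (+ 1 ≤ℤ_) (+-identityʳ (+ k)) (≤-trans 1≤k+[0⊓d] (+-monoʳ-≤ (+ k) (i⊓j≤i (+ 0) d))))
  (subst (_≤ℤ + n) (+-identityʳ (+ m)) (≤-trans (+-monoʳ-≤ (+ m) (i≤i⊔j (+ 0) d)) m+[0⊔d]≤n))
  (≤-trans 1≤k+[0⊓d] (+-monoʳ-≤ (+ k) (i⊓j≤j (+ 0) d)))
  (≤-trans (+-monoʳ-≤ (+ m) (i≤j⊔i (+ 0) d)) m+[0⊔d]≤n)
  where
  1≤k+[0⊓d] : + 1 ≤ℤ + k + (+ 0 ⊓ d)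
  1≤k+[0⊓d] = i-k≤j⇒i≤j+k (+ 0 ⊓ d) 1-[0⊓d]≤k
  m+[0⊔d]≤n : + m + (+ 0 ⊔ d) ≤ℤ + n
  m+[0⊔d]≤n = i≤j-k⇒i+k≤j (+ 0 ⊔ d) m≤n-[0⊔d]

≈ₘ𝟎⇔empty : ∀ {P : Matrix n} → P ≈ₘ band a b e → Fits n a b e → P ≈ₘ 𝟎 ⇔ b < a
≈ₘ𝟎⇔empty {n} {a} {b} {e} {P} P≈band fits = mk⇔ zero⇒empty empty⇒zero
  where
  zero⇒empty : P ≈ₘ 𝟎 → b < a
  zero⇒empty P≈𝟎 with a ≤? b
  ... | no a≰b = ≰⇒> a≰b
  ... | yes a≤b with band-row fits ≤-refl a≤b
  ...   | i , j , _ , on with trans (sym (band-on on)) (trans (sym (P≈band i j)) (P≈𝟎 i j))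
  ...     | ()
  empty⇒zero : b < a → P ≈ₘ 𝟎
  empty⇒zero b<a i j =
    trans (P≈band i j) (band-off λ (a≤i , i≤b , _) → ≤⇒≯ (≤-trans a≤i i≤b) b<a)

band-≈⇒rows⊆ : ∀ {a b e a′ b′ e′ p} → band {n} a b e ≈ₘ band a′ b′ e′ → Fits n a b e
            → a ≤ℤ p → p ≤ℤ b → a′ ≤ℤ p × p ≤ℤ b′
band-≈⇒rows⊆ {a = a} {b} {e} {a′} {b′} {e′} eq fits a≤p p≤b with band-row fits a≤p p≤b
... | i , j , refl , on
    with band-support {a = a′} {b′} {e′} (trans (sym (eq i j)) (band-on {a = a} {b} {e} on))
...   | a′≤i , i≤b′ , _ = a′≤i , i≤b′

band-≈⇒rows≡ : ∀ {a b e a′ b′ e′} → band {n} a b e ≈ₘ band a′ b′ e′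
             → Fits n a b e → Fits n a′ b′ e′ → a ≤ℤ b → a ≡ a′ × b ≡ b′
band-≈⇒rows≡ {n} {a} {b} {e} {a′} {b′} {e′} eq fits fits′ a≤b =
  ≤-antisym (proj₁ (band-≈⇒rows⊆ {a = a′} {b′} {e′} {a} {b} {e} eq′ fits′ ≤-refl a′≤b′)) a′≤a ,
  ≤-antisym b≤b′ (proj₂ (band-≈⇒rows⊆ {a = a′} {b′} {e′} {a} {b} {e} eq′ fits′ a′≤b′ ≤-refl))
  where
  eq′ : band a′ b′ e′ ≈ₘ band a b e
  eq′ i j = sym (eq i j)
  a′≤a : a′ ≤ℤ a
  a′≤a = proj₁ (band-≈⇒rows⊆ {a = a} {b} {e} {a′} {b′} {e′} eq fits ≤-refl a≤b)
  b≤b′ : b ≤ℤ b′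
  b≤b′ = proj₂ (band-≈⇒rows⊆ {a = a} {b} {e} {a′} {b′} {e′} eq fits a≤b ≤-refl)
  a′≤b′ : a′ ≤ℤ b′
  a′≤b′ = ≤-trans a′≤a (≤-trans a≤b b≤b′)

≈ₘ⇔same-rows : ∀ {a b a′ b′ e} {P R : Matrix n}
             → P ≈ₘ band a b e → Fits n a b e → R ≈ₘ band a′ b′ e → Fits n a′ b′ e
             → (P ≈ₘ R × ¬ P ≈ₘ 𝟎) ⇔ (a ≡ a′ × a ≤ℤ b × b ≡ b′)
≈ₘ⇔same-rows {n} {a} {b} {a′} {b′} {e} {P} {R} P≈band fits R≈band fits′ =
  mk⇔ equal⇒rows≡ rows≡⇒equal
  where
  equal⇒rows≡ : P ≈ₘ R × ¬ P ≈ₘ 𝟎 → a ≡ a′ × a ≤ℤ b × b ≡ b′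
  equal⇒rows≡ (P≈R , P≉𝟎) = proj₁ rows≡ , a≤b , proj₂ rows≡
    where
    a≤b : a ≤ℤ b
    a≤b = ≮⇒≥ (P≉𝟎 ∘ from (≈ₘ𝟎⇔empty P≈band fits))
    bands≈ : band a b e ≈ₘ band a′ b′ e
    bands≈ i j = trans (sym (P≈band i j)) (trans (P≈R i j) (R≈band i j))
    rows≡ : a ≡ a′ × b ≡ b′
    rows≡ = band-≈⇒rows≡ {a = a} {b} {e} {a′} {b′} {e} bands≈ fits fits′ a≤b
  rows≡⇒equal : a ≡ a′ × a ≤ℤ b × b ≡ b′ → P ≈ₘ R × ¬ P ≈ₘ 𝟎
  rows≡⇒equal (refl , a≤b , refl) =
    (λ i j → trans (P≈band i j) (sym (R≈band i j))) ,
    (≤⇒≯ a≤b ∘ to (≈ₘ𝟎⇔empty P≈band fits))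

proposition11 : (n : ℕ) → 2 ≤ n → (d d′ : ℤ) → (k m k′ m′ : ℕ)
    → Valid n d k m → Valid n d′ k′ m′
    → (((⟨_,_,_⟩ {n} d k m ⊗ ⟨ d′ , k′ , m′ ⟩) ≈ₘ (⟨ d′ , k′ , m′ ⟩ ⊗ ⟨ d , k , m ⟩)
         × ¬ ((⟨_,_,_⟩ {n} d k m ⊗ ⟨ d′ , k′ , m′ ⟩) ≈ₘ 𝟎))
       ⇔ ((+ k ⊔ (+ k′ - d)) ≡ (+ k′ ⊔ (+ k - d′))
         × (+ k ⊔ (+ k′ - d)) ≤ℤ (+ m ⊓ (+ m′ - d))
         × (+ m ⊓ (+ m′ - d)) ≡ (+ m′ ⊓ (+ m - d′))))
    × (((⟨_,_,_⟩ {n} d k m ⊗ ⟨ d′ , k′ , m′ ⟩) ≈ₘ 𝟎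
         × (⟨_,_,_⟩ {n} d′ k′ m′ ⊗ ⟨ d , k , m ⟩) ≈ₘ 𝟎)
       ⇔ ((+ k ⊔ (+ k′ - d)) > (+ m ⊓ (+ m′ - d))
         × (+ k′ ⊔ (+ k - d′)) > (+ m′ ⊓ (+ m - d′))))
proposition11 n _ d d′ k m k′ m′ valid valid′ =
  ≈ₘ⇔same-rows xy fits-xy yx fits-yx ,
  (≈ₘ𝟎⇔empty xy fits-xy ×-⇔ ≈ₘ𝟎⇔empty yx′ fits-yx′)
  where
  X Y : Matrix n
  X = ⟨ d , k , m ⟩
  Y = ⟨ d′ , k′ , m′ ⟩
  A B A′ B′ : ℤ
  A = + k ⊔ (+ k′ - d)
  B = + m ⊓ (+ m′ - d)
  A′ = + k′ ⊔ (+ k - d′)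
  B′ = + m′ ⊓ (+ m - d′)
  X-fits : Fits n (+ k) (+ m) d
  X-fits = valid⇒fits valid
  Y-fits : Fits n (+ k′) (+ m′) d′
  Y-fits = valid⇒fits valid′
  xy : (X ⊗ Y) ≈ₘ band A B (d + d′)
  xy = band-⊗ {a = + k} {+ m} {d} {+ k′} {+ m′} {d′} Y-fits
  yx′ : (Y ⊗ X) ≈ₘ band A′ B′ (d′ + d)
  yx′ = band-⊗ {a = + k′} {+ m′} {d′} {+ k} {+ m} {d} X-fits
  yx : (Y ⊗ X) ≈ₘ band A′ B′ (d + d′)
  yx = subst (λ e → (Y ⊗ X) ≈ₘ band A′ B′ e) (+-comm d′ d) yx′
  fits-xy : Fits n A B (d + d′)
  fits-xy = fits-⊗ X-fits Y-fits
  fits-yx′ : Fits n A′ B′ (d′ + d)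
  fits-yx′ = fits-⊗ Y-fits X-fits
  fits-yx : Fits n A′ B′ (d + d′)
  fits-yx = subst (Fits n A′ B′) (+-comm d′ d) fits-yx′
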